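{- For $n\geq 2$ let $m_n$ denote the minimum of $\|\lambda\|_2^2$ over all partitions $\lambda$ of $n$ with $\operatorname{rank}(\lambda)\geq 0$ (equivalently, the minimum of $x^{2}+r(a+1)^{2}+(x-1-r)a^{2}$ over integers $x\in\{2,\ldots,n\}$, where $n-x=a(x-1)+r$ with $a\in\mathbb{N}_0$, $0\leq r<x-1$, subject to $x\geq a$ if $r=0$ and $x\geq a+1$ otherwise). Then $m_n=\Theta(n^{4/3})$; more precisely, $$\frac{n^{4/3}}{4}\leq m_n\leq \left(2^{ -2/3}+2^{1/3}\right)n^{4/3}\quad\text{for all } n\geq 28.$$
   Context: A partition of $n$ is a nonincreasing finite sequence $\lambda=(\lambda_1,\ldots,\lambda_k)$ of positive integers with sum $n$; $\|\lambda\|_2^2=\sum_i\lambda_i^2$; the rank of $\lambda$ is $\lambda_1-k$. $\mathbb{N}_0$ is the set of nonnegative integers. -}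

module Defs where

open import Data.Nat using (ℕ; _≥_; _<_; _*_)
open import Data.Integer using (ℤ; +_; _-_)
open import Data.List using (List; []; _∷_; map; length)
open import Data.Nat.ListAction using (sum)
open import Data.List.Relation.Unary.All using (All)
open import Data.List.Relation.Unary.Linked using (Linked)
open import Relation.Binary.PropositionalEquality using (_≡_)

record IsPartition (n : ℕ) (ps : List ℕ) : Set where
  field
    nonincreasing : Linked _≥_ ps
    positive      : All (λ k → 0 < k) ps
    sums          : sum ps ≡ n

-- largest part λ₁ (0 for the empty list, which only partitions 0)
largest : List ℕ → ℕ
largest []      = 0
largest (x ∷ _) = x

rank : List ℕ → ℤ
rank ps = + largest ps - + length ps

normSq : List ℕ → ℕ
normSq ps = sum (map (λ k → k * k) ps)

{-# OPTIONS --safe #-}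
module Submission where

-- Lower bound: by Cauchy–Schwarz n² ≤ k‖λ‖², the number k of parts is at most λ₁ because the rank
-- is nonnegative, and λ₁² ≤ ‖λ‖²; hence n⁴ ≤ λ₁²‖λ‖⁴ ≤ ‖λ‖⁶.
-- Upper bound: let x be the integer cube root of n²/2 and take the rank-zero partition with largest
-- part x followed by x − 1 nearly equal parts summing to n − x. Their squares sum to about
-- (n − x)²/(x − 1), so x‖λ‖² ≤ x³ + n² − 14x, while 4(x³ + n²)³ ≥ 27x³n⁴ is AM–GM with equality
-- exactly at 2x³ = n². The rounding error e = n² − 2x³ ≤ 7x² costs e²(9x³ + 4e) = O(x⁷), which the
-- slack 14x absorbs once x ≥ 7, i.e. once n ≥ 28.

open import Defs
open import Data.Nat using (ℕ; _≤_; _*_; _^_)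
open import Data.Integer using (0ℤ) renaming (_≤_ to _≤ℤ_)
open import Data.List using (List)
open import Data.Product using (_×_; ∃)

open import Data.Nat using (zero; suc; _+_; _∸_; _<_; _≥_; _<?_; z≤n; s≤s; NonZero)
open import Data.Nat.Properties
open import Data.Nat.DivMod using (_/_; _%_; m≡m%n+[m/n]*n; m%n<n; m≥n⇒m/n>0; m<n*o⇒m/o<n)
open import Data.Nat.Tactic.RingSolver using (solve-∀)
open import Data.Integer using (+≤+)
open import Data.Integer.Properties using (i≤j⇒0≤j-i; 0≤i-j⇒j≤i; drop‿+≤+)
open import Data.List using ([]; _∷_; length; map; replicate; _++_)
open import Data.List.Properties using (length-++; length-replicate; map-++; map-replicate)
open import Data.Nat.ListAction using (sum)
open import Data.Nat.ListAction.Properties using (sum-++)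
open import Data.List.Relation.Unary.All using (All; _∷_)
open import Data.List.Relation.Unary.All.Properties using (++⁺; replicate⁺)
open import Data.List.Relation.Unary.Linked using (Linked; [-]; _∷_)
open import Data.Product using (_,_)
open import Data.Sum using (inj₁; inj₂)
open import Relation.Nullary using (yes; no)
open import Relation.Binary.PropositionalEquality

m+n≡o⇒m≤o : ∀ {m n o} → m + n ≡ o → m ≤ o
m+n≡o⇒m≤o {m} refl = m≤m+n m _

2*m*n≤m*m+n*n : ∀ m n → 2 * m * n ≤ m * m + n * n
2*m*n≤m*m+n*n m n with ≤-total m n
... | inj₁ m≤n with d , refl ← m≤n⇒∃[o]m+o≡n m≤n =
  m+n≡o⇒m≤o (expand m d)
  where expand : ∀ m d → 2 * m * (m + d) + d * d ≡ m * m + (m + d) * (m + d)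
        expand = solve-∀
... | inj₂ n≤m with d , refl ← m≤n⇒∃[o]m+o≡n n≤m =
  m+n≡o⇒m≤o (expand n d)
  where expand : ∀ n d → 2 * (n + d) * n + d * d ≡ (n + d) * (n + d) + n * n
        expand = solve-∀

2*m*sum≤length*m*m+normSq : ∀ m xs → 2 * m * sum xs ≤ length xs * (m * m) + normSq xs
2*m*sum≤length*m*m+normSq m [] = ≤-reflexive (*-zeroʳ (2 * m))
2*m*sum≤length*m*m+normSq m (x ∷ xs) = begin
  2 * m * (x + sum xs)                                    ≡⟨ *-distribˡ-+ (2 * m) x (sum xs) ⟩
  2 * m * x + 2 * m * sum xs                              ≤⟨ +-mono-≤ (2*m*n≤m*m+n*n m x) (2*m*sum≤length*m*m+normSq m xs) ⟩
  (m * m + x * x) + (length xs * (m * m) + normSq xs)     ≡⟨ regroup (m * m) (x * x) (length xs) (normSq xs) ⟩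
  suc (length xs) * (m * m) + (x * x + normSq xs)         ∎
  where
  open ≤-Reasoning
  regroup : ∀ a b k s → (a + b) + (k * a + s) ≡ (1 + k) * a + (b + s)
  regroup = solve-∀

sum*sum≤length*normSq : ∀ xs → sum xs * sum xs ≤ length xs * normSq xs
sum*sum≤length*normSq [] = z≤n
sum*sum≤length*normSq (x ∷ xs) = begin
  (x + s) * (x + s)                    ≡⟨ expand x s ⟩
  x * x + 2 * x * s + s * s            ≤⟨ +-mono-≤ (+-monoʳ-≤ (x * x) (2*m*sum≤length*m*m+normSq x xs)) (sum*sum≤length*normSq xs) ⟩
  x * x + (k * (x * x) + q) + k * q    ≡⟨ regroup (x * x) k q ⟩
  suc k * (x * x + q)                  ∎
  where
  open ≤-Reasoning
  s = sum xs
  k = length xs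
  q = normSq xs
  expand : ∀ x s → (x + s) * (x + s) ≡ x * x + 2 * x * s + s * s
  expand = solve-∀
  regroup : ∀ a k q → a + (k * a + q) + k * q ≡ (1 + k) * (a + q)
  regroup = solve-∀

0≤rank⇒length≤largest : ∀ ps → 0ℤ ≤ℤ rank ps → length ps ≤ largest ps
0≤rank⇒length≤largest ps 0≤rank = drop‿+≤+ (0≤i-j⇒j≤i 0≤rank)

normSq-lower-bound : ∀ {n} ps → IsPartition n ps → 0ℤ ≤ℤ rank ps → n ^ 4 ≤ normSq ps ^ 3
normSq-lower-bound [] record { sums = refl } _ = z≤n
normSq-lower-bound {n} ps@(l ∷ rest) record { sums = refl } 0≤rank = begin
  n ^ 4                  ≡⟨ square-square n ⟩
  (n * n) * (n * n)      ≤⟨ *-mono-≤ n*n≤l*m n*n≤l*m ⟩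
  (l * m) * (l * m)      ≡⟨ swap l m ⟩
  (l * l) * (m * m)      ≤⟨ *-monoˡ-≤ (m * m) (m≤m+n (l * l) (normSq rest)) ⟩
  m * (m * m)            ≡⟨ cong (λ k → m * (m * k)) (*-identityʳ m) ⟨
  m ^ 3                  ∎
  where
  open ≤-Reasoning
  m = normSq ps
  n*n≤l*m : n * n ≤ l * m
  n*n≤l*m = ≤-trans (sum*sum≤length*normSq ps) (*-monoˡ-≤ m (0≤rank⇒length≤largest ps 0≤rank))
  square-square : ∀ n → n * (n * (n * (n * 1))) ≡ (n * n) * (n * n)
  square-square = solve-∀
  swap : ∀ l m → (l * m) * (l * m) ≡ (l * l) * (m * m)
  swap = solve-∀

∃[x]f[x]≤k<f[1+x] : (f : ℕ → ℕ) → f 0 ≡ 0 → (∀ x → f x < f (suc x)) →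
                    ∀ k → ∃ λ x → f x ≤ k × k < f (suc x)
∃[x]f[x]≤k<f[1+x] f f0≡0 f< 0 = 0 , ≤-reflexive f0≡0 , subst (_< f 1) f0≡0 (f< 0)
∃[x]f[x]≤k<f[1+x] f f0≡0 f< (suc k) with ∃[x]f[x]≤k<f[1+x] f f0≡0 f< k
... | x , fx≤k , k<f[1+x] with suc k <? f (suc x)
...   | yes 1+k<f[1+x] = x , m≤n⇒m≤1+n fx≤k , 1+k<f[1+x]
...   | no 1+k≮f[1+x] = suc x , ≤-reflexive f[1+x]≡1+k , subst (_< f (2 + x)) f[1+x]≡1+k (f< (suc x))
  where f[1+x]≡1+k = ≤-antisym (≮⇒≥ 1+k≮f[1+x]) k<f[1+x]

2x³<2[1+x]³ : ∀ x → 2 * (x * x * x) < 2 * (suc x * suc x * suc x)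
2x³<2[1+x]³ x = *-monoʳ-< 2 (*-mono-< (*-mono-< (n<1+n x) (n<1+n x)) (n<1+n x))

28≤n⇒n²<2[1+x]³⇒7≤x : ∀ {n x} → 28 ≤ n → n * n < 2 * (suc x * suc x * suc x) → 7 ≤ x
28≤n⇒n²<2[1+x]³⇒7≤x {n} {x} 28≤n n²<2[1+x]³ = ≮⇒≥ λ x<7 → <⇒≱ n²<2[1+x]³ (begin
  2 * (suc x * suc x * suc x) ≤⟨ *-monoʳ-≤ 2 (*-mono-≤ (*-mono-≤ x<7 x<7) x<7) ⟩
  2 * (7 * 7 * 7)             ≤⟨ m≤m+n 686 98 ⟩
  28 * 28                     ≤⟨ *-mono-≤ 28≤n 28≤n ⟩
  n * n                       ∎)
  where open ≤-Reasoning

2x³≤n²⇒3x≤n : ∀ {n x} → 7 ≤ x → 2 * (x * x * x) ≤ n * n → 3 * x ≤ n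
2x³≤n²⇒3x≤n 7≤x 2x³≤n² with t , refl ← m≤n⇒∃[o]m+o≡n 7≤x = ≮⇒≥ λ n<3x →
  <⇒≱ (*-mono-< n<3x n<3x) (≤-trans (m+n≡o⇒m≤o (slack t)) 2x³≤n²)
  where
  slack : ∀ t → 3 * (7 + t) * (3 * (7 + t)) + (7 + t) * (7 + t) * (5 + 2 * t) ≡ 2 * ((7 + t) * (7 + t) * (7 + t))
  slack = solve-∀

n²<2[1+x]³⇒n<x² : ∀ {n x} → 7 ≤ x → n * n < 2 * (suc x * suc x * suc x) → n < x * x
n²<2[1+x]³⇒n<x² 7≤x n²<2[1+x]³ with t , refl ← m≤n⇒∃[o]m+o≡n 7≤x = ≰⇒> λ x²≤n →
  <⇒≱ n²<2[1+x]³ (≤-trans (m+n≡o⇒m≤o (slack t)) (*-mono-≤ x²≤n x²≤n))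
  where
  slack : ∀ t → 2 * ((8 + t) * (8 + t) * (8 + t)) + (1377 + 988 * t + 246 * (t * t) + 26 * (t * t * t) + t * t * t * t) ≡
          (7 + t) * (7 + t) * ((7 + t) * (7 + t))
  slack = solve-∀

2x³+e<2[1+x]³⇒e≤7x² : ∀ {x e} → 7 ≤ x → 2 * (x * x * x) + e < 2 * (suc x * suc x * suc x) → e ≤ 7 * (x * x)
2x³+e<2[1+x]³⇒e≤7x² {e = e} 7≤x 2x³+e<2[1+x]³ with t , refl ← m≤n⇒∃[o]m+o≡n 7≤x =
  ≤-pred (+-cancelˡ-< (2 * (x * x * x)) e _ (<-≤-trans 2x³+e<2[1+x]³ (m+n≡o⇒m≤o (slack t))))
  where
  x = 7 + t
  slack : ∀ t → 2 * ((8 + t) * (8 + t) * (8 + t)) + (6 + 8 * t + t * t) ≡ 2 * ((7 + t) * (7 + t) * (7 + t)) + (1 + 7 * ((7 + t) * (7 + t)))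
  slack = solve-∀

-- 4(3c + e)³ exceeds 27c(2c + e)² by e²(9c + 4e); the slack D pays for it through
-- 4(Q + D)³ ≥ 4Q³ + 12DQ², where Q ≥ M is what remains of 3c + e after D.
slack⇒4M³≤27c[2c+e]² : ∀ {c e D M} → D + 2 * c ≤ 3 * c + e → e * e * (9 * c + 4 * e) ≤ 12 * D * ((2 * c) * (2 * c)) →
                       D + M ≤ 3 * c + e → 4 * (M * M * M) ≤ 27 * c * ((2 * c + e) * (2 * c + e))
slack⇒4M³≤27c[2c+e]² {c} {e} {D} {M} D+2c≤P error≤ D+M≤P with k , D+2c+k≡P ← m≤n⇒∃[o]m+o≡n D+2c≤P =
  ≤-trans (*-monoʳ-≤ 4 (*-mono-≤ (*-mono-≤ M≤Q M≤Q) M≤Q)) (+-cancelʳ-≤ (12 * D * (Q * Q)) _ _ 4Q³+slack≤)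
  where
  open ≤-Reasoning
  Q = 2 * c + k
  D+Q≡P : D + Q ≡ 3 * c + e
  D+Q≡P = trans (sym (+-assoc D (2 * c) k)) D+2c+k≡P
  M≤Q : M ≤ Q
  M≤Q = +-cancelˡ-≤ D M Q (subst (D + M ≤_) (sym D+Q≡P) D+M≤P)
  cube-expand : ∀ D Q → 4 * ((D + Q) * (D + Q) * (D + Q)) ≡
                4 * (Q * Q * Q) + 12 * D * (Q * Q) + (12 * Q * (D * D) + 4 * (D * D * D))
  cube-expand = solve-∀
  cube-split : ∀ c e → 4 * ((3 * c + e) * (3 * c + e) * (3 * c + e)) ≡
               27 * c * ((2 * c + e) * (2 * c + e)) + e * e * (9 * c + 4 * e)
  cube-split = solve-∀
  4Q³+slack≤ : 4 * (Q * Q * Q) + 12 * D * (Q * Q) ≤ 27 * c * ((2 * c + e) * (2 * c + e)) + 12 * D * (Q * Q)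
  4Q³+slack≤ = begin
    4 * (Q * Q * Q) + 12 * D * (Q * Q)                             ≤⟨ m≤m+n _ _ ⟩
    4 * (Q * Q * Q) + 12 * D * (Q * Q) + (12 * Q * (D * D) + 4 * (D * D * D))
                                                                   ≡⟨ cube-expand D Q ⟨
    4 * ((D + Q) * (D + Q) * (D + Q))                              ≡⟨ cong (λ p → 4 * (p * p * p)) D+Q≡P ⟩
    4 * ((3 * c + e) * (3 * c + e) * (3 * c + e))                  ≡⟨ cube-split c e ⟩
    27 * c * ((2 * c + e) * (2 * c + e)) + e * e * (9 * c + 4 * e) ≤⟨ +-monoʳ-≤ _ error≤ ⟩
    27 * c * ((2 * c + e) * (2 * c + e)) + 12 * D * ((2 * c) * (2 * c))
                                                                   ≤⟨ +-monoʳ-≤ _ (*-monoʳ-≤ (12 * D) (*-mono-≤ 2c≤Q 2c≤Q)) ⟩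
    27 * c * ((2 * c + e) * (2 * c + e)) + 12 * D * (Q * Q)        ∎
    where 2c≤Q = m≤m+n (2 * c) k

7≤x⇒4M³≤27x³[2x³+e]² : ∀ {x e M} → 7 ≤ x → e ≤ 7 * (x * x) → 14 * x + M ≤ 3 * (x * x * x) + e →
                       4 * (M * M * M) ≤ 27 * (x * x * x) * ((2 * (x * x * x) + e) * (2 * (x * x * x) + e))
7≤x⇒4M³≤27x³[2x³+e]² {e = e} {M} 7≤x e≤7x² D+M≤P with t , refl ← m≤n⇒∃[o]m+o≡n 7≤x =
  slack⇒4M³≤27c[2c+e]² {x * x * x} {e} {14 * x} {M} (≤-trans (m+n≡o⇒m≤o (slack t)) (m≤m+n _ e)) error≤ D+M≤P
  where
  open ≤-Reasoning
  x = 7 + t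
  slack : ∀ t → 14 * (7 + t) + 2 * ((7 + t) * (7 + t) * (7 + t)) + (7 + t) * (35 + 14 * t + t * t) ≡
          3 * ((7 + t) * (7 + t) * (7 + t))
  slack = solve-∀
  error-slack : ∀ t → let x = 7 + t in
                7 * (x * x) * (7 * (x * x)) * (9 * (x * x * x) + 4 * (7 * (x * x))) + x * x * x * x * x * x * (231 * t + 245) ≡
                12 * (14 * x) * ((2 * (x * x * x)) * (2 * (x * x * x)))
  error-slack = solve-∀
  error≤ : e * e * (9 * (x * x * x) + 4 * e) ≤ 12 * (14 * x) * ((2 * (x * x * x)) * (2 * (x * x * x)))
  error≤ = begin
    e * e * (9 * (x * x * x) + 4 * e)
      ≤⟨ *-mono-≤ (*-mono-≤ e≤7x² e≤7x²) (+-monoʳ-≤ (9 * (x * x * x)) (*-monoʳ-≤ 4 e≤7x²)) ⟩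
    7 * (x * x) * (7 * (x * x)) * (9 * (x * x * x) + 4 * (7 * (x * x)))
      ≤⟨ m+n≡o⇒m≤o (error-slack t) ⟩
    12 * (14 * x) * ((2 * (x * x * x)) * (2 * (x * x * x))) ∎

balanced : ℕ → ℕ → ℕ → List ℕ
balanced q r s = replicate r (suc q) ++ replicate s q

sum-replicate : ∀ r a → sum (replicate r a) ≡ r * a
sum-replicate zero    a = refl
sum-replicate (suc r) a = cong (a +_) (sum-replicate r a)

normSq-replicate : ∀ r a → normSq (replicate r a) ≡ r * (a * a)
normSq-replicate r a = trans (cong sum (map-replicate (λ k → k * k) r a)) (sum-replicate r (a * a))

normSq-++ : ∀ xs ys → normSq (xs ++ ys) ≡ normSq xs + normSq ys
normSq-++ xs ys = trans (cong sum (map-++ (λ k → k * k) xs ys)) (sum-++ (map (λ k → k * k) xs) _)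

balanced-length : ∀ q r s → length (balanced q r s) ≡ r + s
balanced-length q r s = trans (length-++ (replicate r (suc q))) (cong₂ _+_ (length-replicate r) (length-replicate s))

balanced-sum : ∀ q r s → sum (balanced q r s) ≡ r + q * (r + s)
balanced-sum q r s = begin
  sum (balanced q r s)                             ≡⟨ sum-++ (replicate r (suc q)) (replicate s q) ⟩
  sum (replicate r (suc q)) + sum (replicate s q)  ≡⟨ cong₂ _+_ (sum-replicate r (suc q)) (sum-replicate s q) ⟩
  r * suc q + s * q                                ≡⟨ regroup q r s ⟩
  r + q * (r + s)                                  ∎
  where
  open ≡-Reasoning
  regroup : ∀ q r s → r * (1 + q) + s * q ≡ r + q * (r + s)
  regroup = solve-∀

balanced-normSq : ∀ q r s → normSq (balanced q r s) ≡ r * (suc q * suc q) + s * (q * q)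
balanced-normSq q r s =
  trans (normSq-++ (replicate r (suc q)) (replicate s q)) (cong₂ _+_ (normSq-replicate r (suc q)) (normSq-replicate s q))

balanced-positive : ∀ {q} r s → 0 < q → All (λ k → 0 < k) (balanced q r s)
balanced-positive r s 0<q = ++⁺ (replicate⁺ r (s≤s z≤n)) (replicate⁺ s 0<q)

replicate-linked : ∀ {a b} s → b ≤ a → Linked _≥_ (a ∷ replicate s b)
replicate-linked zero    _   = [-]
replicate-linked (suc s) b≤a = b≤a ∷ replicate-linked s ≤-refl

balanced-linked : ∀ {a q} r s → suc q ≤ a → Linked _≥_ (a ∷ balanced q r s)
balanced-linked {q = q} zero s 1+q≤a = replicate-linked s (≤-trans (n≤1+n q) 1+q≤a)
balanced-linked (suc r) s 1+q≤a = 1+q≤a ∷ balanced-linked r s ≤-refl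

balanced-normSq-bound : ∀ q r s {y N} → r + s ≡ y → sum (balanced q r s) ≡ N →
                        suc y * normSq (balanced q r s) ≤ N * N + y * y + suc q * N
balanced-normSq-bound q r s refl refl rewrite balanced-sum q r s | balanced-normSq q r s = begin
  (1 + y) * m           ≡⟨ variance q r s ⟩
  N * N + r * s + m     ≤⟨ +-mono-≤ (+-monoʳ-≤ (N * N) (*-mono-≤ (m≤m+n r s) (m≤n+m s r))) m≤[1+q]*N ⟩
  N * N + y * y + suc q * N ∎
  where
  open ≤-Reasoning
  y = r + s
  N = r + q * y
  m = r * (suc q * suc q) + s * (q * q)
  -- y·Σaᵢ² − (Σaᵢ)² = Σ_{i<j} (aᵢ − aⱼ)², and exactly r·s pairs of parts differ, by 1.
  variance : ∀ q r s → (1 + (r + s)) * (r * ((1 + q) * (1 + q)) + s * (q * q)) ≡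
             (r + q * (r + s)) * (r + q * (r + s)) + r * s + (r * ((1 + q) * (1 + q)) + s * (q * q))
  variance = solve-∀
  m+sq≡[1+q]*N : ∀ q r s → r * ((1 + q) * (1 + q)) + s * (q * q) + s * q ≡ (1 + q) * (r + q * (r + s))
  m+sq≡[1+q]*N = solve-∀
  m≤[1+q]*N : m ≤ suc q * N
  m≤[1+q]*N = m+n≡o⇒m≤o (m+sq≡[1+q]*N q r s)

module RankZeroPartition (y N : ℕ) .{{_ : NonZero y}} where

  q = N / y
  r = N % y
  s = y ∸ r

  parts : List ℕ
  parts = suc y ∷ balanced q r s

  r+s≡y : r + s ≡ y
  r+s≡y = m+[n∸m]≡n (<⇒≤ (m%n<n N y))

  sum-balanced : sum (balanced q r s) ≡ N
  sum-balanced = begin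
    sum (balanced q r s)  ≡⟨ balanced-sum q r s ⟩
    r + q * (r + s)       ≡⟨ cong (λ k → r + q * k) r+s≡y ⟩
    r + q * y             ≡⟨ m≡m%n+[m/n]*n N y ⟨
    N                     ∎
    where open ≡-Reasoning

  q<1+y : suc y + N < suc y * suc y → q < suc y
  q<1+y n<x² = m<n*o⇒m/o<n (+-cancelˡ-< (suc y) N _ (subst (suc y + N <_) (*-suc (suc y) y) n<x²))

  parts-isPartition : y ≤ N → suc y + N < suc y * suc y → IsPartition (suc y + N) parts
  parts-isPartition y≤N n<x² = record
    { nonincreasing = balanced-linked r s (q<1+y n<x²)
    ; positive      = s≤s z≤n ∷ balanced-positive r s (m≥n⇒m/n>0 y≤N)
    ; sums          = cong (suc y +_) sum-balanced
    }

  parts-rank : 0ℤ ≤ℤ rank parts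
  parts-rank = i≤j⇒0≤j-i (+≤+ (≤-reflexive (cong suc (trans (balanced-length q r s) r+s≡y))))

  parts-normSq-bound : 14 ≤ N → suc y + N < suc y * suc y →
                       14 * suc y + suc y * normSq parts ≤ suc y * suc y * suc y + (suc y + N) * (suc y + N)
  parts-normSq-bound 14≤N n<x² = begin
    14 * x + x * (x * x + m)                  ≡⟨ regroup x m ⟩
    x * x * x + (x * m + 14 * x)              ≤⟨ +-monoʳ-≤ (x * x * x) (+-mono-≤ x*m≤ (*-monoˡ-≤ x 14≤N)) ⟩
    x * x * x + (N * N + x * x + x * N + N * x) ≡⟨ cong (x * x * x +_) (square x N) ⟩
    x * x * x + (x + N) * (x + N)             ∎
    where
    open ≤-Reasoning
    x = suc y
    m = normSq (balanced q r s)
    regroup : ∀ x m → 14 * x + x * (x * x + m) ≡ x * x * x + (x * m + 14 * x)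
    regroup = solve-∀
    square : ∀ x N → N * N + x * x + x * N + N * x ≡ (x + N) * (x + N)
    square = solve-∀
    x*m≤ : x * m ≤ N * N + x * x + x * N
    x*m≤ = ≤-trans (balanced-normSq-bound q r s r+s≡y sum-balanced)
                   (+-mono-≤ (+-monoʳ-≤ (N * N) (*-mono-≤ (n≤1+n y) (n≤1+n y))) (*-monoˡ-≤ N (q<1+y n<x²)))

partition-near-cube-root : ∀ {n x} → 7 ≤ x → 2 * (x * x * x) ≤ n * n → n * n < 2 * (suc x * suc x * suc x) →
                           ∃ λ ps → IsPartition n ps × 0ℤ ≤ℤ rank ps × 4 * normSq ps ^ 3 ≤ 27 * n ^ 4
partition-near-cube-root {x = zero}    ()
partition-near-cube-root {x = suc zero} (s≤s ())
partition-near-cube-root {n} {x@(suc y@(suc _))} 7≤x 2x³≤n² n²<2[1+x]³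
  with N , refl ← m≤n⇒∃[o]m+o≡n (≤-trans (m≤m+n x (2 * x)) (2x³≤n²⇒3x≤n {n} 7≤x 2x³≤n²))
  with e , 2x³+e≡n² ← m≤n⇒∃[o]m+o≡n 2x³≤n²
  = parts , parts-isPartition y≤N n<x² , parts-rank , 4m³≤27n⁴
  where
  open RankZeroPartition y N
  open ≤-Reasoning
  c = x * x * x
  m = normSq parts
  2x≤N : 2 * x ≤ N
  2x≤N = +-cancelˡ-≤ x (2 * x) N (2x³≤n²⇒3x≤n 7≤x 2x³≤n²)
  y≤N : y ≤ N
  y≤N = ≤-trans (n≤1+n y) (≤-trans (m≤m+n x (x + 0)) 2x≤N)
  n<x² : x + N < x * x
  n<x² = n²<2[1+x]³⇒n<x² 7≤x n²<2[1+x]³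
  e≤7x² : e ≤ 7 * (x * x)
  e≤7x² = 2x³+e<2[1+x]³⇒e≤7x² 7≤x (subst (_< 2 * (suc x * suc x * suc x)) (sym 2x³+e≡n²) n²<2[1+x]³)
  D+M≤P : 14 * x + x * m ≤ 3 * c + e
  D+M≤P = begin
    14 * x + x * m          ≤⟨ parts-normSq-bound (≤-trans (*-monoʳ-≤ 2 7≤x) 2x≤N) n<x² ⟩
    c + (x + N) * (x + N)   ≡⟨ cong (c +_) 2x³+e≡n² ⟨
    c + (2 * c + e)         ≡⟨ +-assoc c (2 * c) e ⟨
    3 * c + e               ∎
  cube-product : ∀ x m → x * x * x * (4 * (m * (m * (m * 1)))) ≡ 4 * (x * m * (x * m) * (x * m))
  cube-product = solve-∀
  fourth-power : ∀ c n → 27 * c * (n * n * (n * n)) ≡ c * (27 * (n * (n * (n * (n * 1)))))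
  fourth-power = solve-∀
  4m³≤27n⁴ : 4 * m ^ 3 ≤ 27 * (x + N) ^ 4
  4m³≤27n⁴ = *-cancelˡ-≤ c (begin
    c * (4 * m ^ 3)                                      ≡⟨ cube-product x m ⟩
    4 * (x * m * (x * m) * (x * m))                      ≤⟨ 7≤x⇒4M³≤27x³[2x³+e]² {x} {e} {x * m} 7≤x e≤7x² D+M≤P ⟩
    27 * c * ((2 * c + e) * (2 * c + e))                 ≡⟨ cong (λ k → 27 * c * (k * k)) 2x³+e≡n² ⟩
    27 * c * ((x + N) * (x + N) * ((x + N) * (x + N)))   ≡⟨ fourth-power c (x + N) ⟩
    c * (27 * (x + N) ^ 4)                               ∎)

normSq-upper-bound : ∀ {n} → 28 ≤ n → ∃ λ ps → IsPartition n ps × 0ℤ ≤ℤ rank ps × 4 * normSq ps ^ 3 ≤ 27 * n ^ 4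
normSq-upper-bound {n} 28≤n
  with x , 2x³≤n² , n²<2[1+x]³ ← ∃[x]f[x]≤k<f[1+x] (λ x → 2 * (x * x * x)) refl 2x³<2[1+x]³ (n * n)
  = partition-near-cube-root {n} {x} (28≤n⇒n²<2[1+x]³⇒7≤x 28≤n n²<2[1+x]³) 2x³≤n² n²<2[1+x]³

theorem3 : (n : ℕ) → 28 ≤ n →
    ((ps : List ℕ) → IsPartition n ps → 0ℤ ≤ℤ rank ps → n ^ 4 ≤ (4 * normSq ps) ^ 3)
    × ∃ (λ ps → IsPartition n ps × 0ℤ ≤ℤ rank ps × 4 * normSq ps ^ 3 ≤ 27 * n ^ 4)
theorem3 n 28≤n = lower , normSq-upper-bound 28≤n
  where
  lower : (ps : List ℕ) → IsPartition n ps → 0ℤ ≤ℤ rank ps → n ^ 4 ≤ (4 * normSq ps) ^ 3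
  lower ps isPartition 0≤rank =
    ≤-trans (normSq-lower-bound ps isPartition 0≤rank) (^-monoˡ-≤ 3 (m≤n*m (normSq ps) 4))
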